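{- Let $q\equiv 3\pmod 8$ be an odd prime power and $\beta\in NQR(q)\setminus\{ -1\}$ with $\beta\notin\{2,2^{ -1}\}$. For $i\in\mathbb{F}_q$ let $F_i=\{\{\infty,i\}\}\cup\{\{x+i,x\beta+i\}: x\in QR(q)\}$ and $G_i=\{\{\infty,i\}\}\cup\{\{y+i,y\beta+i\}: y\in NQR(q)\}$, so that $\mathcal{F}=\{F_i\}$ and $\mathcal{G}=\{G_i\}$ are the orthogonal one-factorizations of the complete graph on $\mathbb{F}_q\cup\{\infty\}$ generated by the starters $S_\beta$ and $-S_\beta$. Then for no $F\in\mathcal{F}$, $G\in\mathcal{G}$ does $F\cup G$ contain a cycle $C_4$ of length four with $\infty\in V(C_4)$.
   Context: For an odd prime power $q$, $QR(q)$ and $NQR(q)$ denote the sets of nonzero squares and non-squares of $\mathbb{F}_q$. $S_\beta=\{\{x,x\beta\}:x\in QR(q)\}$ and $-S_\beta=\{\{ -x,-x\beta\}:x\in QR(q)\}$. Two one-factorizations $\mathcal{F},\mathcal{G}$ of a graph are orthogonal if $|F\cap G|\le 1$ for all $F\in\mathcal{F}$, $G\in\mathcal{G}$. -}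

module Defs where

open import Level using (0ℓ)
open import Data.Nat using (ℕ)
open import Data.Fin using (Fin)
open import Data.Maybe using (Maybe; just; nothing)
open import Data.Product using (Σ; ∃; _×_; _,_)
open import Data.Sum using (_⊎_)
open import Relation.Nullary using (¬_; Dec)
open import Relation.Binary.PropositionalEquality using (_≡_; _≢_)
open import Algebra.Structures using (IsCommutativeRing)
open import Function.Bundles using (_↔_)

record FiniteField (q : ℕ) : Set₁ where
  infixl 6 _+_
  infixl 7 _*_
  field
    Carrier : Set
    _+_ _*_ : Carrier → Carrier → Carrier
    -_      : Carrier → Carrier
    0# 1#   : Carrier
    isCommutativeRing : IsCommutativeRing {A = Carrier} _≡_ _+_ _*_ -_ 0# 1#
    0≢1     : 0# ≢ 1#
    inverse : ∀ x → x ≢ 0# → ∃ λ y → x * y ≡ 1#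
    _≟_     : (x y : Carrier) → Dec (x ≡ y)
    enumeration : Fin q ↔ Carrier

  QR : Carrier → Set
  QR x = x ≢ 0# × ∃ λ y → y * y ≡ x

  NQR : Carrier → Set
  NQR x = x ≢ 0# × ¬ (∃ λ y → y * y ≡ x)

  two : Carrier
  two = 1# + 1#

  Vertex : Set
  Vertex = Maybe Carrier

  ∞ : Vertex
  ∞ = nothing

  SameEdge : Vertex → Vertex → Vertex → Vertex → Set
  SameEdge u v a b = (u ≡ a × v ≡ b) ⊎ (u ≡ b × v ≡ a)

  InF : Carrier → Carrier → Vertex → Vertex → Set
  InF β i u v = SameEdge u v ∞ (just i)
              ⊎ ∃ λ x → QR x × SameEdge u v (just (x + i)) (just (x * β + i))

  InG : Carrier → Carrier → Vertex → Vertex → Set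
  InG β i u v = SameEdge u v ∞ (just i)
              ⊎ ∃ λ y → NQR y × SameEdge u v (just (y + i)) (just (y * β + i))

  InFG : Carrier → Carrier → Carrier → Vertex → Vertex → Set
  InFG β i j u v = InF β i u v ⊎ InG β j u v

  HasC4Through∞ : Carrier → Carrier → Carrier → Set
  HasC4Through∞ β i j = Σ Vertex λ v₁ → Σ Vertex λ v₂ → Σ Vertex λ v₃ →
      (∞ ≢ v₁ × ∞ ≢ v₂ × ∞ ≢ v₃ × v₁ ≢ v₂ × v₁ ≢ v₃ × v₂ ≢ v₃)
    × InFG β i j ∞ v₁ × InFG β i j v₁ v₂ × InFG β i j v₂ v₃ × InFG β i j v₃ ∞

-- Edges of F_i ∪ G_j at ∞ lead to i and j, so a 4-cycle through ∞ is ∞ - i - b - j - ∞.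
-- Apart from {∞, i} no edge of F_i meets i, and no edge of G_j other than {∞, j} meets j, so
-- {i, b} = {y + j, yβ + j} with y a non-square and {b, j} = {x + i, xβ + i} with x a nonzero
-- square. Comparing the differences b - j = (b - i) + (i - j) in the four orientations,
-- two of them force β = 2 or 2β = 1, and the other two force β² - β + 1 = 0; then β³ = -1,
-- which makes y a square multiple of x, a contradiction.
module Submission where

open import Data.Nat using (ℕ; _%_)
open import Data.Product using (∃; _×_; _,_; proj₁)
import Data.Product as Product
open import Data.Sum using (_⊎_; inj₁; inj₂)
import Data.Sum as Sum
open import Data.Maybe using (just; nothing)
open import Data.Maybe.Properties using (just-injective)
open import Data.Empty using (⊥; ⊥-elim)
open import Relation.Nullary using (¬_)
open import Relation.Binary.PropositionalEquality
  using (_≡_; _≢_; refl; sym; trans; cong; module ≡-Reasoning)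
open import Algebra.Bundles using (CommutativeRing; CommutativeSemiring)
open import Algebra.Structures using (IsCommutativeRing)
import Algebra.Definitions
import Algebra.Properties.Ring as RingProperties
import Algebra.Solver.Ring.NaturalCoefficients.Default as SemiringSolver

open import Defs

module StarterFactorizations {q : ℕ} (K : FiniteField q) where

  open FiniteField K
  open IsCommutativeRing isCommutativeRing
    using (+-identityˡ; *-identityˡ; zeroˡ; zeroʳ; isCommutativeSemiring)
  open Algebra.Definitions {A = Carrier} _≡_ using (AlmostLeftCancellative)
  open ≡-Reasoning

  commutativeRing : CommutativeRing _ _
  commutativeRing = record { isCommutativeRing = isCommutativeRing }

  commutativeSemiring : CommutativeSemiring _ _
  commutativeSemiring = record { isCommutativeSemiring = isCommutativeSemiring }

  open RingProperties (CommutativeRing.ring commutativeRing) using (+-cancelʳ; +-identityˡ-unique)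
  open SemiringSolver commutativeSemiring using (solve; _:+_; _:*_; _:=_; con)

  *-cancelˡ-nonZero : AlmostLeftCancellative 0# _*_
  *-cancelˡ-nonZero y a b y≢0 ya≡yb with inverse y y≢0
  ... | z , yz≡1 = begin
    a           ≡⟨ sym (*-identityˡ a) ⟩
    1# * a      ≡⟨ cong (_* a) (sym yz≡1) ⟩
    y * z * a   ≡⟨ solve 3 (λ y z a → y :* z :* a := z :* (y :* a)) refl y z a ⟩
    z * (y * a) ≡⟨ cong (z *_) ya≡yb ⟩
    z * (y * b) ≡⟨ solve 3 (λ y z b → z :* (y :* b) := y :* z :* b) refl y z b ⟩
    y * z * b   ≡⟨ cong (_* b) yz≡1 ⟩
    1# * b      ≡⟨ *-identityˡ b ⟩
    b           ∎

  *-nonZero : ∀ {x y} → x ≢ 0# → y ≢ 0# → x * y ≢ 0#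
  *-nonZero {x} {y} x≢0 y≢0 xy≡0 =
    y≢0 (*-cancelˡ-nonZero x y 0# x≢0 (trans xy≡0 (sym (zeroʳ x))))

  IsSquare : Carrier → Set
  IsSquare x = ∃ λ w → w * w ≡ x

  isSquare-*-square : ∀ {x y} s → y ≡ x * (s * s) → IsSquare x → IsSquare y
  isSquare-*-square {x} {y} s y≡xs² (w , w²≡x) = w * s , (begin
    w * s * (w * s) ≡⟨ solve 2 (λ w s → w :* s :* (w :* s) := w :* w :* (s :* s)) refl w s ⟩
    w * w * (s * s) ≡⟨ cong (_* (s * s)) w²≡x ⟩
    x * (s * s)     ≡⟨ sym y≡xs² ⟩
    y               ∎)

  -- (β + 1)(β² + 1) = β³ + 1 + (β² + β), while β² + 1 = β makes it β² + β.
  cube+1≡0 : ∀ {β} → β * β + 1# ≡ β → β * β * β + 1# ≡ 0#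
  cube+1≡0 {β} β²+1≡β = +-cancelʳ (β * β + β) _ _ (begin
    β * β * β + 1# + (β * β + β) ≡⟨ solve 1 (λ β → β :* β :* β :+ con 1 :+ (β :* β :+ β)
                                               := (β :+ con 1) :* (β :* β :+ con 1)) refl β ⟩
    (β + 1#) * (β * β + 1#)      ≡⟨ cong ((β + 1#) *_) β²+1≡β ⟩
    (β + 1#) * β                 ≡⟨ solve 1 (λ β → (β :+ con 1) :* β := con 0 :+ (β :* β :+ β)) refl β ⟩
    0# + (β * β + β)             ∎)

  -- Since b - j = (b - i) + (i - j) and (i - j) + (j - i) = 0.
  differences : ∀ {i j b p r s t} → i ≡ p + j → b ≡ r + j → b ≡ s + i → j ≡ t + i →
                p + t ≡ 0# × r ≡ s + p
  differences {j = j} {p = p} {r} {s} {t} refl refl r+j≡s+i j≡t+i =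
      sym (+-cancelʳ j 0# (p + t) (begin
        0# + j          ≡⟨ +-identityˡ j ⟩
        j               ≡⟨ j≡t+i ⟩
        t + (p + j)     ≡⟨ solve 3 (λ p t j → t :+ (p :+ j) := p :+ t :+ j) refl p t j ⟩
        p + t + j       ∎))
    , +-cancelʳ j r (s + p) (begin
        r + j           ≡⟨ r+j≡s+i ⟩
        s + (p + j)     ≡⟨ solve 3 (λ s p j → s :+ (p :+ j) := s :+ p :+ j) refl s p j ⟩
        s + p + j       ∎)

  square-ratio₁ : ∀ {x y β} → y ≢ 0# → y + x * β ≡ 0# × y * β ≡ x + y →
                  y ≡ x * (β * β * (β * β))
  square-ratio₁ {x} {y} {β} y≢0 (y+xβ≡0 , yβ≡x+y) = +-cancelʳ (x * β) y _ (begin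
    y + x * β                             ≡⟨ y+xβ≡0 ⟩
    0#                                    ≡⟨ sym (zeroʳ (x * β)) ⟩
    x * β * 0#                            ≡⟨ cong (x * β *_) (sym (cube+1≡0 β²+1≡β)) ⟩
    x * β * (β * β * β + 1#)              ≡⟨ solve 2 (λ x β → x :* β :* (β :* β :* β :+ con 1)
                                                      := x :* (β :* β :* (β :* β)) :+ x :* β) refl x β ⟩
    x * (β * β * (β * β)) + x * β         ∎)
    where
    β²+1≡β : β * β + 1# ≡ β
    β²+1≡β = *-cancelˡ-nonZero y _ _ y≢0 (begin
      y * (β * β + 1#)   ≡⟨ solve 2 (λ y β → y :* (β :* β :+ con 1) := y :* β :* β :+ y) refl y β ⟩
      y * β * β + y      ≡⟨ cong (λ t → t * β + y) yβ≡x+y ⟩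
      (x + y) * β + y    ≡⟨ solve 3 (λ x y β → (x :+ y) :* β :+ y := y :+ x :* β :+ y :* β) refl x y β ⟩
      y + x * β + y * β  ≡⟨ cong (_+ y * β) y+xβ≡0 ⟩
      0# + y * β         ≡⟨ +-identityˡ (y * β) ⟩
      y * β              ∎)

  square-ratio₂ : ∀ {x y β} → y ≢ 0# → y * β + x ≡ 0# × y ≡ x * β + y * β →
                  y ≡ x * (β * β)
  square-ratio₂ {x} {y} {β} y≢0 (yβ+x≡0 , y≡xβ+yβ) = +-cancelʳ (y * (β * β * β)) y _ (begin
    y + y * (β * β * β)          ≡⟨ solve 2 (λ y β → y :+ y :* (β :* β :* β) := y :* (β :* β :* β :+ con 1)) refl y β ⟩
    y * (β * β * β + 1#)         ≡⟨ cong (y *_) (cube+1≡0 β²+1≡β) ⟩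
    y * 0#                       ≡⟨ zeroʳ y ⟩
    0#                           ≡⟨ sym (zeroˡ (β * β)) ⟩
    0# * (β * β)                 ≡⟨ cong (_* (β * β)) (sym yβ+x≡0) ⟩
    (y * β + x) * (β * β)        ≡⟨ solve 3 (λ x y β → (y :* β :+ x) :* (β :* β)
                                             := x :* (β :* β) :+ y :* (β :* β :* β)) refl x y β ⟩
    x * (β * β) + y * (β * β * β) ∎)
    where
    β²+1≡β : β * β + 1# ≡ β
    β²+1≡β = *-cancelˡ-nonZero y _ _ y≢0 (+-cancelʳ (x * β) _ _ (begin
      y * (β * β + 1#) + x * β   ≡⟨ solve 3 (λ x y β → y :* (β :* β :+ con 1) :+ x :* β
                                              := (y :* β :+ x) :* β :+ y) refl x y β ⟩
      (y * β + x) * β + y        ≡⟨ cong (λ t → t * β + y) yβ+x≡0 ⟩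
      0# * β + y                 ≡⟨ cong (_+ y) (zeroˡ β) ⟩
      0# + y                     ≡⟨ +-identityˡ y ⟩
      y                          ≡⟨ y≡xβ+yβ ⟩
      x * β + y * β              ≡⟨ solve 3 (λ x y β → x :* β :+ y :* β := y :* β :+ x :* β) refl x y β ⟩
      y * β + x * β              ∎))

  forces-β*two≡1 : ∀ {x y β} → y ≢ 0# → y + x ≡ 0# × y * β ≡ x * β + y → β * two ≡ 1#
  forces-β*two≡1 {x} {y} {β} y≢0 (y+x≡0 , yβ≡xβ+y) = *-cancelˡ-nonZero y _ _ y≢0 (begin
    y * (β * two)          ≡⟨ solve 2 (λ y β → y :* (β :* (con 1 :+ con 1)) := y :* β :+ y :* β) refl y β ⟩
    y * β + y * β          ≡⟨ cong (_+ y * β) yβ≡xβ+y ⟩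
    x * β + y + y * β      ≡⟨ solve 3 (λ x y β → x :* β :+ y :+ y :* β := (y :+ x) :* β :+ y) refl x y β ⟩
    (y + x) * β + y        ≡⟨ cong (λ t → t * β + y) y+x≡0 ⟩
    0# * β + y             ≡⟨ solve 2 (λ y β → con 0 :* β :+ y := y :* con 1) refl y β ⟩
    y * 1#                 ∎)

  forces-β≡two : ∀ {x y β} → y ≢ 0# → β ≢ 0# → y * β + x * β ≡ 0# × y ≡ x + y * β → β ≡ two
  forces-β≡two {x} {y} {β} y≢0 β≢0 (yβ+xβ≡0 , y≡x+yβ) =
    *-cancelˡ-nonZero y _ _ y≢0 (+-cancelʳ x _ _ (begin
      y * β + x        ≡⟨ solve 3 (λ x y β → y :* β :+ x := x :+ y :* β) refl x y β ⟩
      x + y * β        ≡⟨ sym y≡x+yβ ⟩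
      y                ≡⟨ solve 1 (λ y → y := y :+ con 0) refl y ⟩
      y + 0#           ≡⟨ cong (y +_) (sym y+x≡0) ⟩
      y + (y + x)      ≡⟨ solve 2 (λ x y → y :+ (y :+ x) := y :* (con 1 :+ con 1) :+ x) refl x y ⟩
      y * two + x      ∎))
    where
    y+x≡0 : y + x ≡ 0#
    y+x≡0 = *-cancelˡ-nonZero β _ _ β≢0 (begin
      β * (y + x)      ≡⟨ solve 3 (λ x y β → β :* (y :+ x) := y :* β :+ x :* β) refl x y β ⟩
      y * β + x * β    ≡⟨ yβ+xβ≡0 ⟩
      0#               ≡⟨ sym (zeroʳ β) ⟩
      β * 0#           ∎)

  -- InF β i = OneFactor QR β i and InG β i = OneFactor NQR β i hold definitionally.
  OneFactor : (Carrier → Set) → Carrier → Carrier → Vertex → Vertex → Set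
  OneFactor P β i u v = SameEdge u v ∞ (just i)
                      ⊎ ∃ λ x → P x × SameEdge u v (just (x + i)) (just (x * β + i))

  SameEdge-sym : ∀ {u v a b} → SameEdge u v a b → SameEdge v u a b
  SameEdge-sym (inj₁ (u≡a , v≡b)) = inj₂ (v≡b , u≡a)
  SameEdge-sym (inj₂ (u≡b , v≡a)) = inj₁ (v≡a , u≡b)

  SameEdge-just : ∀ {a b c d} → SameEdge (just a) (just b) (just c) (just d) →
                  (a ≡ c × b ≡ d) ⊎ (a ≡ d × b ≡ c)
  SameEdge-just = Sum.map (Product.map just-injective just-injective)
                          (Product.map just-injective just-injective)

  OneFactor-sym : ∀ {P β i u v} → OneFactor P β i u v → OneFactor P β i v u
  OneFactor-sym = Sum.map SameEdge-sym (Product.map₂ (Product.map₂ SameEdge-sym))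

  OneFactor-∞ : ∀ {P β i v} → OneFactor P β i ∞ v → v ≡ just i
  OneFactor-∞ (inj₁ (inj₁ (_ , v≡i))) = v≡i
  OneFactor-∞ (inj₁ (inj₂ (() , _)))
  OneFactor-∞ (inj₂ (_ , _ , inj₁ (() , _)))
  OneFactor-∞ (inj₂ (_ , _ , inj₂ (() , _)))

  OneFactor-centre : ∀ {P β i v} → (∀ {x} → P x → x ≢ 0#) → β ≢ 0# →
                     OneFactor P β i (just i) v → v ≡ ∞
  OneFactor-centre _ _ (inj₁ (inj₁ (() , _)))
  OneFactor-centre _ _ (inj₁ (inj₂ (_ , v≡∞))) = v≡∞
  OneFactor-centre {i = i} nonZero _ (inj₂ (x , px , inj₁ (i≡x+i , _))) =
    ⊥-elim (nonZero px (+-identityˡ-unique x i (sym (just-injective i≡x+i))))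
  OneFactor-centre {i = i} nonZero β≢0 (inj₂ (x , px , inj₂ (i≡xβ+i , _))) =
    ⊥-elim (*-nonZero (nonZero px) β≢0 (+-identityˡ-unique _ i (sym (just-injective i≡xβ+i))))

  InFG-sym : ∀ {β i j u v} → InFG β i j u v → InFG β i j v u
  InFG-sym = Sum.map OneFactor-sym OneFactor-sym

  InFG-∞ : ∀ {β i j v} → InFG β i j ∞ v → v ≡ just i ⊎ v ≡ just j
  InFG-∞ = Sum.map OneFactor-∞ OneFactor-∞

  no-G-F-path : ∀ {β i j b} → β ≢ 0# → β ≢ two → β * two ≢ 1# →
                InG β j (just i) (just b) → InF β i (just b) (just j) → ⊥
  no-G-F-path _ _ _ (inj₁ (inj₁ (() , _))) _
  no-G-F-path _ _ _ (inj₁ (inj₂ (_ , ()))) _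
  no-G-F-path _ _ _ (inj₂ _) (inj₁ (inj₁ (() , _)))
  no-G-F-path _ _ _ (inj₂ _) (inj₁ (inj₂ (_ , ())))
  no-G-F-path {β} β≢0 β≢2 β*2≢1 (inj₂ (y , (y≢0 , y-nonSquare) , g)) (inj₂ (x , (_ , x-square) , f))
    with SameEdge-just g | SameEdge-just f
  ... | inj₁ (i≡ , b≡) | inj₁ (b≡′ , j≡) =
    y-nonSquare (isSquare-*-square (β * β) (square-ratio₁ y≢0 (differences i≡ b≡ b≡′ j≡)) x-square)
  ... | inj₁ (i≡ , b≡) | inj₂ (b≡′ , j≡) = β*2≢1 (forces-β*two≡1 y≢0 (differences i≡ b≡ b≡′ j≡))
  ... | inj₂ (i≡ , b≡) | inj₁ (b≡′ , j≡) = β≢2 (forces-β≡two y≢0 β≢0 (differences i≡ b≡ b≡′ j≡))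
  ... | inj₂ (i≡ , b≡) | inj₂ (b≡′ , j≡) =
    y-nonSquare (isSquare-*-square β (square-ratio₂ y≢0 (differences i≡ b≡ b≡′ j≡)) x-square)

  InFG-at-i : ∀ {β i j b} → β ≢ 0# → InFG β i j (just i) (just b) → InG β j (just i) (just b)
  InFG-at-i β≢0 (inj₁ f) with () ← OneFactor-centre proj₁ β≢0 f
  InFG-at-i _   (inj₂ g) = g

  InFG-at-j : ∀ {β i j b} → β ≢ 0# → InFG β i j (just b) (just j) → InF β i (just b) (just j)
  InFG-at-j _   (inj₁ f) = f
  InFG-at-j β≢0 (inj₂ g) with () ← OneFactor-centre proj₁ β≢0 (OneFactor-sym g)

  no-i-b-j-path : ∀ {β i j b} → β ≢ 0# → β ≢ two → β * two ≢ 1# →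
                  InFG β i j (just i) (just b) → InFG β i j (just b) (just j) → ⊥
  no-i-b-j-path β≢0 β≢2 β*2≢1 ib bj =
    no-G-F-path β≢0 β≢2 β*2≢1 (InFG-at-i β≢0 ib) (InFG-at-j β≢0 bj)

  no-C4-through-∞ : ∀ {β i j} → β ≢ 0# → β ≢ two → β * two ≢ 1# → ¬ HasC4Through∞ β i j
  no-C4-through-∞ _ _ _ (_ , nothing , _ , (_ , ∞≢v₂ , _) , _) = ∞≢v₂ refl
  no-C4-through-∞ β≢0 β≢2 β*2≢1 (_ , just b , _ , (_ , _ , _ , _ , v₁≢v₃ , _) , e₀ , e₁ , e₂ , e₃)
    with InFG-∞ e₀ | InFG-∞ (InFG-sym e₃)
  ... | inj₁ refl | inj₁ refl = v₁≢v₃ refl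
  ... | inj₂ refl | inj₂ refl = v₁≢v₃ refl
  ... | inj₁ refl | inj₂ refl = no-i-b-j-path β≢0 β≢2 β*2≢1 e₁ e₂
  ... | inj₂ refl | inj₁ refl = no-i-b-j-path β≢0 β≢2 β*2≢1 (InFG-sym e₂) (InFG-sym e₁)

mainTheorem7 : (q : ℕ) → (K : FiniteField q) → q % 8 ≡ 3 →
    let open FiniteField K in
    (β : Carrier) → NQR β → β ≢ - 1# → β ≢ two → β * two ≢ 1# →
    (i j : Carrier) → ¬ HasC4Through∞ β i j
mainTheorem7 q K _ β (β≢0 , _) _ β≢2 β*2≢1 i j = StarterFactorizations.no-C4-through-∞ K β≢0 β≢2 β*2≢1
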